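{- Let $\wp\in\mathrm{Qnt}(V)$ be a quantification prefix over a set of variables $V$, $D$ a set, and $P\subseteq\mathrm{Val}_D(V)$ a set of valuations. Suppose that for every dependence map $\theta\in\mathrm{DM}_D(\wp)$ there is a valuation $v\in\mathrm{Val}_D(\mathcal{U}(\wp))$ with $\theta(v)\in P$. Then there exists a dependence map $\overline\theta\in\mathrm{DM}_D(\overline\wp)$ such that $\overline\theta(\overline v)\in P$ for all valuations $\overline v\in\mathrm{Val}_D(\mathcal{U}(\overline\wp))$.
   Context: A quantification prefix over a finite set $V$ of variables is a word over $\{\langle\langle x\rangle\rangle,[[x]]:x\in V\}$ (existential/universal quantifiers) in which each $x\in V$ occurs exactly once; $\mathrm{Qnt}(V)$ is their set. $\mathcal{E}(\wp)$, $\mathcal{U}(\wp)$ are its existentially/universally quantified variables; for $y\in\mathcal{E}(\wp)$, $\mathrm{Dep}(\wp,y)$ is the set of $x\in\mathcal{U}(\wp)$ occurring before $y$ in $\wp$. The dual $\overline\wp$ is obtained by replacing each $\langle\langle x\rangle\rangle$ by $[[x]]$ and vice versa. $\mathrm{Val}_D(W)$ is the set of functions $W\to D$. A dependence map for $\wp$ over $D$ is $\theta:\mathrm{Val}_D(\mathcal{U}(\wp))\to\mathrm{Val}_D(V)$ such that (1) $\theta(v)|_{\mathcal{U}(\wp)}=v$, and (2) for every $x\in\mathcal{E}(\wp)$, $\theta(v_1)(x)=\theta(v_2)(x)$ whenever $v_1,v_2$ agree on $\mathrm{Dep}(\wp,x)$. $\mathrm{DM}_D(\wp)$ is the set of dependence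 maps. -}

module Defs where

open import Data.Nat using (ℕ)
open import Data.Bool using (Bool; true; false; if_then_else_; _∧_; T)
open import Data.Fin using (Fin; _≟_)
open import Data.List using (List; []; _∷_; map)
open import Data.List.Membership.Propositional using (_∈_)
open import Data.List.Relation.Unary.Unique.Propositional using (Unique)
open import Data.Product using (_×_; _,_; proj₁; proj₂; Σ)
open import Relation.Nullary.Decidable using (⌊_⌋)
open import Relation.Binary.PropositionalEquality using (_≡_)

-- Quantifiers: ex = ⟨⟨x⟩⟩ (existential), all = [[x]] (universal)
data Quant : Set where
  ex all : Quant

-- The finite variable set V is represented as Fin n.
-- A word over {⟨⟨x⟩⟩, [[x]] : x ∈ V}.
Word : ℕ → Set
Word n = List (Quant × Fin n)

IsQnt : {n : ℕ} → Word n → Set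
IsQnt {n} ℘ = Unique (map proj₂ ℘) × ((x : Fin n) → x ∈ map proj₂ ℘)

isAll : Quant → Bool
isAll ex  = false
isAll all = true

isEx : Quant → Bool
isEx ex  = true
isEx all = false

-- x ∈ 𝒰(℘)  (boolean; first occurrence)
isU : {n : ℕ} → Word n → Fin n → Bool
isU [] x = false
isU ((q , z) ∷ ℘) x = if ⌊ z ≟ x ⌋ then isAll q else isU ℘ x

isE : {n : ℕ} → Word n → Fin n → Bool
isE [] x = false
isE ((q , z) ∷ ℘) x = if ⌊ z ≟ x ⌋ then isEx q else isE ℘ x

before : {n : ℕ} → Word n → Fin n → Fin n → Bool
before [] x y = false
before ((q , z) ∷ ℘) x y =
  if ⌊ z ≟ y ⌋ then false else (if ⌊ z ≟ x ⌋ then true else before ℘ x y)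

inDep : {n : ℕ} → Word n → Fin n → Fin n → Bool
inDep ℘ y x = isU ℘ x ∧ before ℘ x y

flipQ : Quant → Quant
flipQ ex  = all
flipQ all = ex

dual : {n : ℕ} → Word n → Word n
dual = map (λ { (q , x) → (flipQ q , x) })

ValU : {n : ℕ} → Word n → Set → Set
ValU {n} ℘ D = (x : Fin n) → T (isU ℘ x) → D

Val : ℕ → Set → Set
Val n D = Fin n → D

record IsDM {n : ℕ} (℘ : Word n) (D : Set) (θ : ValU ℘ D → Val n D) : Set where
  field
    restrict : (v : ValU ℘ D) (x : Fin n) (u : T (isU ℘ x)) → θ v x ≡ v x u
    depend   : (x : Fin n) → T (isE ℘ x) → (v₁ v₂ : ValU ℘ D) →
               ((y : Fin n) (u : T (isU ℘ y)) → T (inDep ℘ x y) → v₁ y u ≡ v₂ y u) →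
               θ v₁ x ≡ θ v₂ x

DM : {n : ℕ} → Word n → Set → Set
DM {n} ℘ D = Σ (ValU ℘ D → Val n D) (IsDM ℘ D)

module Submission where

-- The proof goes through the ordinary first-order reading of a prefix.
--  * Sat Q w ρ reads w as a string of quantifiers over D applied to Q,
--    starting from an environment ρ that fixes the variables not yet bound.
--  * Skolemisation (skolem): for a prefix without repeated variables, a proof
--    of Sat Q w ρ yields a dependence map for w all of whose outcomes satisfy
--    Q; it is built quantifier by quantifier (skolem-∀, skolem-∃).
--  * De Morgan duality (dualise): classically, ¬ Sat (¬ P) ℘ ρ gives
--    Sat P (dual ℘) ρ.
-- The theorem follows: if Sat (¬ P) ℘ ρ held, its Skolem map would contradict
-- the hypothesis, so Sat P (dual ℘) ρ holds and its Skolem map is the answer.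
-- This needs a starting environment ρ; when there is none (D empty), either
-- the dual prefix has no universal valuation at all (everything is vacuous),
-- or one exists and then constantDM turns it into a dependence map for ℘ whose
-- outcome, supplied by the hypothesis, is a valuation after all.

open import Defs
open import Data.Nat using (ℕ)
open import Data.Product using (Σ; _,_; proj₁; proj₂)
open import Level using (0ℓ)
open import Axiom.ExcludedMiddle using (ExcludedMiddle)
open import Axiom.DoubleNegationElimination using (em⇒dne)
open import Data.Bool using (Bool; true; false; T)
open import Data.Bool.Properties using (T-irrelevant)
open import Data.Empty using (⊥-elim)
open import Data.Sum using (_⊎_; inj₁; inj₂)
open import Data.Fin using (Fin; _≟_)
open import Data.List using ([]; _∷_; map)
open import Data.List.Membership.Propositional using (_∈_)
open import Data.List.Relation.Unary.All using (All; _∷_; lookup)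
open import Data.List.Relation.Unary.Any using (here; there)
open import Data.List.Relation.Unary.AllPairs using (_∷_)
open import Data.List.Relation.Unary.Unique.Propositional using (Unique)
open import Data.Vec.Functional using (updateAt)
open import Data.Vec.Functional.Properties using (updateAt-updates; updateAt-minimal)
open import Function using (const)
open import Relation.Nullary using (¬_; Dec; yes; no)
open import Relation.Nullary.Decidable using (⌊_⌋; isYes≗does; dec-true; dec-false)
open import Relation.Binary.PropositionalEquality

variable
  n : ℕ
  D : Set
  q : Quant
  x y y' : Fin n
  w : Word n

Fresh : Fin n → Word n → Set
Fresh x w = All (x ≢_) (map proj₂ w)

same-var : (x : Fin n) → ⌊ x ≟ x ⌋ ≡ true
same-var x = trans (isYes≗does (x ≟ x)) (dec-true (x ≟ x) refl)

other-var : x ≢ y → ⌊ x ≟ y ⌋ ≡ false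
other-var {x = x} {y} x≢y = trans (isYes≗does (x ≟ y)) (dec-false (x ≟ y) x≢y)

isU-head : (q : Quant) (x : Fin n) (w : Word n) → isU ((q , x) ∷ w) x ≡ isAll q
isU-head q x w rewrite same-var x = refl

isE-head : (q : Quant) (x : Fin n) (w : Word n) → isE ((q , x) ∷ w) x ≡ isEx q
isE-head q x w rewrite same-var x = refl

isU-tail : (w : Word n) → x ≢ y → isU ((q , x) ∷ w) y ≡ isU w y
isU-tail {x = x} {y} w x≢y rewrite other-var x≢y = refl

isE-tail : (w : Word n) → x ≢ y → isE ((q , x) ∷ w) y ≡ isE w y
isE-tail {x = x} {y} w x≢y rewrite other-var x≢y = refl

inDep-head : (w : Word n) → x ≢ y → T (inDep ((all , x) ∷ w) y x)
inDep-head {x = x} {y} w x≢y rewrite same-var x | other-var x≢y = _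

inDep-tail : (w : Word n) → x ≢ y → x ≢ y' → inDep ((q , x) ∷ w) y y' ≡ inDep w y y'
inDep-tail {x = x} {y} {y'} w x≢y x≢y'
  rewrite other-var x≢y | other-var x≢y' = refl

isU-occurs : (w : Word n) → T (isU w y) → y ∈ map proj₂ w
isU-occurs {y = y} ((q , z) ∷ w) u with z ≟ y
... | yes refl = here refl
... | no _     = there (isU-occurs w u)

occurs-quantified : (w : Word n) → y ∈ map proj₂ w → T (isU w y) ⊎ T (isE w y)
occurs-quantified {y = y} ((q , z) ∷ w) y∈w with z ≟ y | q | y∈w
... | yes _    | all | _      = inj₁ _
... | yes _    | ex  | _      = inj₂ _
... | no  z≢y  | _   | here p = ⊥-elim (z≢y (sym p))
... | no  _    | _   | there m = occurs-quantified w m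

isE-not-isU : (w : Word n) → T (isE w y) → ¬ T (isU w y)
isE-not-isU {y = y} ((q , z) ∷ w) e u with z ≟ y | q
... | yes _ | ex  = u
... | yes _ | all = e
... | no _  | _   = isE-not-isU w e u

dual-vars : (w : Word n) → map proj₂ (dual w) ≡ map proj₂ w
dual-vars []            = refl
dual-vars ((q , z) ∷ w) = cong (z ∷_) (dual-vars w)

isU-dual : (w : Word n) (y : Fin n) → isU (dual w) y ≡ isE w y
isU-dual []             y = refl
isU-dual ((ex , z) ∷ w)  y with z ≟ y
... | yes _ = refl
... | no _  = isU-dual w y
isU-dual ((all , z) ∷ w) y with z ≟ y
... | yes _ = refl
... | no _  = isU-dual w y

Agree : {n : ℕ} {D : Set} (w : Word n) → Fin n → (v₁ v₂ : ValU w D) → Set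
Agree {n} w y v₁ v₂ = (y' : Fin n) (u : T (isU w y')) → T (inDep w y y') → v₁ y' u ≡ v₂ y' u

_[_↦_] : Val n D → Fin n → D → Val n D
ρ [ x ↦ d ] = updateAt ρ x (const d)

Sat : (Val n D → Set) → Word n → Val n D → Set
Sat         Q []              ρ = Q ρ
Sat {D = D} Q ((all , x) ∷ w) ρ = (d : D) → Sat Q w (ρ [ x ↦ d ])
Sat {D = D} Q ((ex  , x) ∷ w) ρ = Σ D λ d → Sat Q w (ρ [ x ↦ d ])

record Skolem (w : Word n) (Q : Val n D → Set) (ρ : Val n D) : Set where
  field
    θ       : ValU w D → Val n D
    isDM    : IsDM w D θ
    sound   : (v : ValU w D) → Q (θ v)
    outside : (v : ValU w D) (y : Fin n) → Fresh y w → θ v y ≡ ρ y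

module Prepend {q : Quant} {x : Fin n} {w : Word n} (fresh : Fresh x w) where

  bound-≢ : T (isU w y) → x ≢ y
  bound-≢ u = lookup fresh (isU-occurs w u)

  liftU : T (isU w y) → T (isU ((q , x) ∷ w) y)
  liftU u = subst T (sym (isU-tail w (bound-≢ u))) u

  restrict : ValU ((q , x) ∷ w) D → ValU w D
  restrict v y u = v y (liftU u)

  restrict-copies : {θ : ValU w D → Val n D} → IsDM w D θ → x ≢ y →
                    (v : ValU ((q , x) ∷ w) D) (u : T (isU ((q , x) ∷ w) y)) →
                    θ (restrict v) y ≡ v y u
  restrict-copies {y = y} dm x≢y v u =
    trans (IsDM.restrict dm (restrict v) y (subst T (isU-tail w x≢y) u))
          (cong (v y) (T-irrelevant _ _))

  restrict-depends : {θ : ValU w D → Val n D} → IsDM w D θ → x ≢ y →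
                     T (isE ((q , x) ∷ w) y) → (v₁ v₂ : ValU ((q , x) ∷ w) D) →
                     Agree ((q , x) ∷ w) y v₁ v₂ → θ (restrict v₁) y ≡ θ (restrict v₂) y
  restrict-depends {y = y} dm x≢y e v₁ v₂ agree =
    IsDM.depend dm y (subst T (isE-tail w x≢y) e) (restrict v₁) (restrict v₂)
      λ y' u d → agree y' (liftU u) (subst T (sym (inDep-tail w x≢y (bound-≢ u))) d)

  at-x : ∀ {Q : Val n D → Set} {ρ d} (sk : Skolem w Q (ρ [ x ↦ d ])) (v : ValU w D) →
         Skolem.θ sk v x ≡ d
  at-x {ρ = ρ} sk v = trans (Skolem.outside sk v x fresh) (updateAt-updates x ρ)

  outside-step : ∀ {Q : Val n D → Set} {ρ d} (sk : Skolem w Q (ρ [ x ↦ d ])) (v : ValU w D) →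
                 (y : Fin n) → Fresh y ((q , x) ∷ w) → Skolem.θ sk v y ≡ ρ y
  outside-step {ρ = ρ} sk v y (y≢x ∷ fresh-y) =
    trans (Skolem.outside sk v y fresh-y) (updateAt-minimal y x ρ y≢x)

-- Skolemising ∀x: play the Skolem map chosen by the value of x.
skolem-∀ : {Q : Val n D → Set} {ρ : Val n D} → Fresh x w →
           ((d : D) → Skolem w Q (ρ [ x ↦ d ])) → Skolem ((all , x) ∷ w) Q ρ
skolem-∀ {n} {D} {x} {w} fresh sk = record
  { θ = θ ; isDM = record { restrict = copies ; depend = depends }
  ; sound = λ v → Skolem.sound (sk (value-x v)) (restrict v)
  ; outside = λ v → outside-step (sk (value-x v)) (restrict v) }
  where
  open Prepend {q = all} fresh
  x-universal : T (isU ((all , x) ∷ w) x)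
  x-universal = subst T (sym (isU-head all x w)) _
  value-x : ValU ((all , x) ∷ w) D → D
  value-x v = v x x-universal
  θ : ValU ((all , x) ∷ w) D → Val n D
  θ v = Skolem.θ (sk (value-x v)) (restrict v)
  copies-by : (v : ValU ((all , x) ∷ w) D) (y : Fin n) (u : T (isU ((all , x) ∷ w) y)) →
              Dec (x ≡ y) → θ v y ≡ v y u
  copies-by v y u (yes refl) = trans (at-x (sk (value-x v)) (restrict v)) (cong (v x) (T-irrelevant _ _))
  copies-by v y u (no x≢y)   = restrict-copies (Skolem.isDM (sk (value-x v))) x≢y v u
  copies : (v : ValU ((all , x) ∷ w) D) (y : Fin n) (u : T (isU ((all , x) ∷ w) y)) → θ v y ≡ v y u
  copies v y u = copies-by v y u (x ≟ y)
  -- x is a dependency of every existential y, so both valuations pick the same map.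
  depends : (y : Fin n) → T (isE ((all , x) ∷ w) y) → (v₁ v₂ : ValU ((all , x) ∷ w) D) →
            Agree ((all , x) ∷ w) y v₁ v₂ → θ v₁ y ≡ θ v₂ y
  depends y e v₁ v₂ agree =
    trans (restrict-depends (Skolem.isDM (sk (value-x v₁))) x≢y e v₁ v₂ agree)
          (cong (λ d → Skolem.θ (sk d) (restrict v₂) y) (agree x x-universal (inDep-head w x≢y)))
    where
    x≢y : x ≢ y
    x≢y refl = subst T (isE-head all x w) e

-- Skolemising ∃x with witness d: x is constantly d.
skolem-∃ : {Q : Val n D → Set} {ρ : Val n D} → Fresh x w →
           (d : D) → Skolem w Q (ρ [ x ↦ d ]) → Skolem ((ex , x) ∷ w) Q ρ
skolem-∃ {n} {D} {x} {w} fresh d sk = record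
  { θ = θ ; isDM = record { restrict = copies ; depend = depends }
  ; sound = λ v → Skolem.sound sk (restrict v)
  ; outside = λ v → outside-step sk (restrict v) }
  where
  open Prepend {q = ex} fresh
  θ : ValU ((ex , x) ∷ w) D → Val n D
  θ v = Skolem.θ sk (restrict v)
  copies : (v : ValU ((ex , x) ∷ w) D) (y : Fin n) (u : T (isU ((ex , x) ∷ w) y)) → θ v y ≡ v y u
  copies v y u = restrict-copies (Skolem.isDM sk) x≢y v u
    where
    x≢y : x ≢ y
    x≢y refl = subst T (isU-head ex x w) u
  depends-by : (y : Fin n) → T (isE ((ex , x) ∷ w) y) → (v₁ v₂ : ValU ((ex , x) ∷ w) D) →
               Agree ((ex , x) ∷ w) y v₁ v₂ → Dec (x ≡ y) → θ v₁ y ≡ θ v₂ y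
  depends-by y e v₁ v₂ agree (yes refl) = trans (at-x sk (restrict v₁)) (sym (at-x sk (restrict v₂)))
  depends-by y e v₁ v₂ agree (no x≢y)   = restrict-depends (Skolem.isDM sk) x≢y e v₁ v₂ agree
  depends : (y : Fin n) → T (isE ((ex , x) ∷ w) y) → (v₁ v₂ : ValU ((ex , x) ∷ w) D) →
            Agree ((ex , x) ∷ w) y v₁ v₂ → θ v₁ y ≡ θ v₂ y
  depends y e v₁ v₂ agree = depends-by y e v₁ v₂ agree (x ≟ y)

skolem : {Q : Val n D → Set} {ρ : Val n D} → Unique (map proj₂ w) → Sat Q w ρ → Skolem w Q ρ
skolem {w = []} {ρ = ρ} _ s = record
  { θ = const ρ ; isDM = record { restrict = λ _ _ () ; depend = λ _ () }
  ; sound = λ _ → s ; outside = λ _ _ _ → refl }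
skolem {w = (all , x) ∷ w} (fresh ∷ unique) s       = skolem-∀ fresh λ d → skolem unique (s d)
skolem {w = (ex  , x) ∷ w} (fresh ∷ unique) (d , s) = skolem-∃ fresh d (skolem unique s)

dualise : ExcludedMiddle 0ℓ → (P : Val n D → Set) (w : Word n) (ρ : Val n D) →
          ¬ Sat (λ r → ¬ P r) w ρ → Sat P (dual w) ρ
dualise em P []              ρ ¬s = em⇒dne em ¬s
dualise em P ((ex , x) ∷ w)  ρ ¬s = λ d → dualise em P w (ρ [ x ↦ d ]) λ s → ¬s (d , s)
dualise {D = D} em P ((all , x) ∷ w) ρ ¬s =
  proj₁ counterexample , dualise em P w (ρ [ x ↦ proj₁ counterexample ]) (proj₂ counterexample)
  where
  -- ¬ ∀ ⇒ ∃ ¬ , by double negation elimination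
  counterexample : Σ D λ d → ¬ Sat (λ r → ¬ P r) w (ρ [ x ↦ d ])
  counterexample = em⇒dne em λ none → ¬s λ d → em⇒dne em λ ¬s-d → none (d , ¬s-d)

byCases : (b : Bool) → (T b → D) → (¬ T b → D) → D
byCases true  f g = f _
byCases false f g = g λ ()

byCases-true : (b : Bool) (t : T b) (f : T b → D) (g : ¬ T b → D) → byCases b f g ≡ f t
byCases-true true _ _ _ = refl

byCases-false : (b : Bool) → ¬ T b → (f₁ f₂ : T b → D) (g : ¬ T b → D) →
                byCases b f₁ g ≡ byCases b f₂ g
byCases-false true  ¬t = ⊥-elim (¬t _)
byCases-false false _ _ _ _ = refl

-- When every variable occurs in ℘, a universal valuation of the dual prefix
-- fixes all existential variables of ℘ once and for all; together with the
-- universal variables this is a (constant) dependence map for ℘.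
constantDM : (℘ : Word n) → ((y : Fin n) → y ∈ map proj₂ ℘) → ValU (dual ℘) D → DM ℘ D
constantDM {n} {D} ℘ covers v̄ = θ , record { restrict = copies ; depend = constant }
  where
  universal-in-dual : (y : Fin n) → ¬ T (isU ℘ y) → T (isU (dual ℘) y)
  universal-in-dual y ¬u with occurs-quantified ℘ (covers y)
  ... | inj₁ u = ⊥-elim (¬u u)
  ... | inj₂ e = subst T (sym (isU-dual ℘ y)) e
  θ : ValU ℘ D → Val n D
  θ v y = byCases (isU ℘ y) (v y) λ ¬u → v̄ y (universal-in-dual y ¬u)
  copies : (v : ValU ℘ D) (y : Fin n) (u : T (isU ℘ y)) → θ v y ≡ v y u
  copies v y u = byCases-true (isU ℘ y) u (v y) _
  constant : (y : Fin n) → T (isE ℘ y) → (v₁ v₂ : ValU ℘ D) → Agree ℘ y v₁ v₂ → θ v₁ y ≡ θ v₂ y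
  constant y e v₁ v₂ _ = byCases-false (isU ℘ y) (isE-not-isU ℘ e) (v₁ y) (v₂ y) _

vacuousDM : ¬ ValU w D → DM w D
vacuousDM none = (λ v → ⊥-elim (none v))
               , record { restrict = λ v → ⊥-elim (none v) ; depend = λ _ _ v → ⊥-elim (none v) }

skolemDM : {Q : Val n D → Set} {ρ : Val n D} → Skolem w Q ρ → DM w D
skolemDM sk = Skolem.θ sk , Skolem.isDM sk

dualWins : ExcludedMiddle 0ℓ → (℘ : Word n) → Unique (map proj₂ ℘) →
           (P : Val n D → Set) → Val n D →
           ((θ : DM ℘ D) → Σ (ValU ℘ D) (λ v → P (proj₁ θ v))) →
           Σ (DM (dual ℘) D) (λ θ̄ → (v̄ : ValU (dual ℘) D) → P (proj₁ θ̄ v̄))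
dualWins em ℘ unique P ρ eloise-loses with em {Sat (λ r → ¬ P r) ℘ ρ}
... | yes refutation = ⊥-elim (Skolem.sound sk (proj₁ outcome) (proj₂ outcome))
  where
  sk : Skolem ℘ (λ r → ¬ P r) ρ
  sk = skolem unique refutation
  outcome : Σ (ValU ℘ _) (λ v → P (Skolem.θ sk v))
  outcome = eloise-loses (skolemDM sk)
... | no ¬refutation = skolemDM sk , Skolem.sound sk
  where
  sk : Skolem (dual ℘) P ρ
  sk = skolem (subst Unique (sym (dual-vars ℘)) unique) (dualise em P ℘ ρ ¬refutation)

lemmaB2 : ExcludedMiddle 0ℓ →
          {n : ℕ} (℘ : Word n) → IsQnt ℘ →
          (D : Set) (P : Val n D → Set) →
          ((θ : DM ℘ D) → Σ (ValU ℘ D) (λ v → P (proj₁ θ v))) →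
          Σ (DM (dual ℘) D) (λ θ̄ → (v̄ : ValU (dual ℘) D) → P (proj₁ θ̄ v̄))
lemmaB2 em {n} ℘ (unique , covers) D P eloise-loses with em {Val n D}
... | yes ρ = dualWins em ℘ unique P ρ eloise-loses
... | no no-valuation with em {ValU (dual ℘) D}
...   | no no-v̄ = vacuousDM no-v̄ , λ v̄ → ⊥-elim (no-v̄ v̄)
...   | yes v̄  = ⊥-elim (no-valuation (proj₁ θ (proj₁ (eloise-loses θ))))
  where
  -- the universal valuation v̄ of the dual prefix completes any universal
  -- valuation of ℘ to a full valuation, which cannot exist
  θ : DM ℘ D
  θ = constantDM ℘ covers v̄
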